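{- For every graph $G$ with $\chi(G) \ge 2$, $$\lceil \log_2\log_2 \chi(G)\rceil + 1 \;\le\; \sigma(G) \;\le\; 2\lceil \log_2\log_2 \chi(G)\rceil + 2.$$
   Context: $\chi(G)$ is the chromatic number of $G$. An orientation covering of $G$ is a set of orientations $\overrightarrow{G_1},\dots,\overrightarrow{G_k}$ of $G$ such that for every vertex $u$ and any two distinct neighbors $v,w$ of $u$, some $\overrightarrow{G_i}$ contains both arcs $\overrightarrow{uv}$ and $\overrightarrow{uw}$. $\sigma(G)$ is the minimum size of an orientation covering of $G$. -}

module Defs where

open import Level using (0ℓ)
open import Data.Nat using (ℕ; zero; suc; _≤_; _^_; _+_; _*_)
open import Data.Fin using (Fin)
open import Data.Product using (Σ; _×_; ∃-syntax)
open import Data.Sum using (_⊎_)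
open import Relation.Nullary using (¬_)
open import Relation.Binary.PropositionalEquality using (_≡_; _≢_)

record Graph (n : ℕ) : Set₁ where
  field
    Adj   : Fin n → Fin n → Set
    sym   : ∀ {u v} → Adj u v → Adj v u
    irref : ∀ {u} → ¬ Adj u u
open Graph public

IsMin : (ℕ → Set) → ℕ → Set
IsMin P m = P m × (∀ k → P k → m ≤ k)

Colorable : ∀ {n} → Graph n → ℕ → Set
Colorable {n} G k =
  Σ (Fin n → Fin k) λ c → ∀ u v → Adj G u v → c u ≢ c v

IsChromaticNumber : ∀ {n} → Graph n → ℕ → Set
IsChromaticNumber G = IsMin (Colorable G)

record IsOrientation {n} (G : Graph n) (D : Fin n → Fin n → Set) : Set where
  field
    arc⇒edge : ∀ {u v} → D u v → Adj G u v
    edge⇒arc : ∀ {u v} → Adj G u v → D u v ⊎ D v u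
    antisym  : ∀ {u v} → D u v → ¬ D v u

OrientationCovering : ∀ {n} → Graph n → ℕ → Set₁
OrientationCovering {n} G k =
  Σ (Fin k → Fin n → Fin n → Set) λ O →
    (∀ i → IsOrientation G (O i)) ×
    (∀ u v w → Adj G u v → Adj G u w → v ≢ w →
       ∃[ i ] (O i u v × O i u w))

-- A covering has at least one orientation (k ≥ 1), as a set G₁,…,G_k.
HasCoveringOfSize : ∀ {n} → Graph n → ℕ → Set₁
HasCoveringOfSize G k = (1 ≤ k) × OrientationCovering G k

IsSigma : ∀ {n} → Graph n → ℕ → Set₁
IsSigma G s = HasCoveringOfSize G s × (∀ k → HasCoveringOfSize G k → s ≤ k)

-- ⌈log₂ log₂ c⌉ = t  (for c ≥ 2): t is the least natural number with c ≤ 2^(2^t),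
-- since log₂ log₂ c ≤ t ⇔ c ≤ 2^(2^t).
IsCeilLogLog : ℕ → ℕ → Set
IsCeilLogLog c = IsMin (λ t → c ≤ 2 ^ (2 ^ t))

-- Given a covering O₀, …, O_s, the signature of an arc uv of O₀
-- is the set of i ≥ 1 with uv ∈ Oᵢ, and the colour of u is the set of
-- signatures of its out-arcs in O₀: at most 2^(2^s) colours.  If uv ∈ O₀ and
-- u, v had the same colour, v would have an out-arc vx ∈ O₀ with the
-- signature of uv, and no orientation could contain both vu and vx.  Hence
-- χ ≤ 2^(2^s), i.e. t ≤ s.  Computing colours needs decidable arc relations,
-- available only under a double negation, which suffices as t ≤ s is decidable.
--
-- Read colours as bit vectors of length 2^t.  A separating family
-- of 2t + 2 functions Fin (2^t) → Fin 2 (built by induction on t) realises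
-- every consistent pair of prescriptions; the i-th orientation directs an edge
-- xy towards y iff gᵢ agrees with y's colour at the first position where the
-- colours of x and y differ.

module Submission where

open import Defs
open import Data.Nat using (ℕ; _≤_; _+_; _*_)
open import Data.Product using (_×_)

open import Data.Nat using (zero; suc; _^_; s≤s; z≤n; _≤?_)
open import Data.Nat.Properties using (≤-trans; m≤n+m; +-comm; +-assoc; *-suc)
open import Data.Fin using (Fin; zero; suc; _≟_; combine; quotient; remainder; finToFun; funToFin; inject≤)
open import Data.Fin.Properties using (combine-remQuot; finToFun-funToFin; funToFin-finToFin; inject≤-injective; any?)
open import Data.Maybe using (Maybe; just; nothing)
import Data.Maybe as Maybe
open import Data.Maybe.Properties using (just-injective)
open import Data.Product using (Σ; _,_; proj₁; proj₂; ∃-syntax)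
open import Data.Sum using (_⊎_; inj₁; inj₂)
open import Function using (_∘_)
open import Relation.Binary.Definitions using (DecidableEquality)
open import Relation.Nullary using (¬_; Dec; yes; no; contradiction)
open import Relation.Nullary.Negation using (¬¬-map)
open import Relation.Nullary.Decidable using (decidable-stable; ¬¬-excluded-middle; _×-dec_)
open import Relation.Binary.PropositionalEquality
  using (_≡_; _≢_; _≗_; refl; trans; cong; cong₂; subst; ≢-sym; module ≡-Reasoning)
  renaming (sym to ≡-sym)

other : ∀ {a b c : Fin 2} → a ≢ b → c ≢ a → c ≡ b
other {zero}     {zero}               a≢b _   = contradiction refl a≢b
other {suc zero} {suc zero}           a≢b _   = contradiction refl a≢b
other {zero}     {suc zero} {zero}     _   c≢a = contradiction refl c≢a
other {zero}     {suc zero} {suc zero} _   _   = refl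
other {suc zero} {zero}     {zero}     _   _   = refl
other {suc zero} {zero}     {suc zero} _   c≢a = contradiction refl c≢a

flip : Fin 2 → Fin 2
flip zero       = suc zero
flip (suc zero) = zero

flip-≢ : ∀ a → flip a ≢ a
flip-≢ zero       ()
flip-≢ (suc zero) ()

indicator : ∀ {P : Set} → Dec P → Fin 2
indicator (yes _) = suc zero
indicator (no _)  = zero

indicator-transfer : ∀ {P Q : Set} (P? : Dec P) (Q? : Dec Q) →
  indicator P? ≡ indicator Q? → P → Q
indicator-transfer (yes _) (yes q) _  _ = q
indicator-transfer (yes _) (no _)  () _
indicator-transfer (no ¬p) _       _  p = contradiction p ¬p

funToFin-cong : ∀ {N m} {f g : Fin N → Fin m} → f ≗ g → funToFin f ≡ funToFin g
funToFin-cong {zero}  f≗g = refl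
funToFin-cong {suc N} f≗g = cong₂ combine (f≗g zero) (funToFin-cong (f≗g ∘ suc))

funToFin-injective : ∀ {N m} (f g : Fin N → Fin m) → funToFin f ≡ funToFin g → f ≗ g
funToFin-injective f g eq i = begin
  f i                       ≡⟨ ≡-sym (finToFun-funToFin f i) ⟩
  finToFun (funToFin f) i   ≡⟨ cong (λ a → finToFun a i) eq ⟩
  finToFun (funToFin g) i   ≡⟨ finToFun-funToFin g i ⟩
  g i                       ∎
  where open ≡-Reasoning

finToFun-injective : ∀ {N m} (a b : Fin (m ^ N)) → finToFun {m} {N} a ≗ finToFun b → a ≡ b
finToFun-injective {N} {m} a b eq = begin
  a                               ≡⟨ ≡-sym (funToFin-finToFin {N} {m} a) ⟩
  funToFin (finToFun {m} {N} a)   ≡⟨ funToFin-cong eq ⟩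
  funToFin (finToFun {m} {N} b)   ≡⟨ funToFin-finToFin {N} {m} b ⟩
  b                               ∎
  where open ≡-Reasoning

-- It depends
-- only on the unordered pair {f, g}, which makes it usable to orient edges.

module FirstDifference {A : Set} (_≟ᴬ_ : DecidableEquality A) where

  firstDiff : ∀ {N} → (Fin N → A) → (Fin N → A) → Maybe (Fin N)
  firstDiff {zero}  f g = nothing
  firstDiff {suc N} f g with f zero ≟ᴬ g zero
  ... | yes _ = Maybe.map suc (firstDiff (f ∘ suc) (g ∘ suc))
  ... | no _  = just zero

  firstDiff-sym : ∀ {N} (f g : Fin N → A) → firstDiff f g ≡ firstDiff g f
  firstDiff-sym {zero}  f g = refl
  firstDiff-sym {suc N} f g with f zero ≟ᴬ g zero | g zero ≟ᴬ f zero
  ... | yes _   | yes _   = cong (Maybe.map suc) (firstDiff-sym (f ∘ suc) (g ∘ suc))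
  ... | no _    | no _    = refl
  ... | yes f≡g | no g≢f  = contradiction (≡-sym f≡g) g≢f
  ... | no f≢g  | yes g≡f = contradiction (≡-sym g≡f) f≢g

  firstDiff-nothing : ∀ {N} (f g : Fin N → A) → firstDiff f g ≡ nothing → f ≗ g
  firstDiff-nothing {suc N} f g eq i with f zero ≟ᴬ g zero
  ... | no _ = contradiction eq λ ()
  ... | yes f₀≡g₀ with firstDiff (f ∘ suc) (g ∘ suc) in rest
  ...   | just _  = contradiction eq λ ()
  ...   | nothing with i
  ...     | zero  = f₀≡g₀
  ...     | suc j = firstDiff-nothing (f ∘ suc) (g ∘ suc) rest j

  firstDiff-just : ∀ {N} (f g : Fin N → A) {p} → firstDiff f g ≡ just p → f p ≢ g p
  firstDiff-just {suc N} f g eq with f zero ≟ᴬ g zero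
  ... | no f₀≢g₀ rewrite just-injective (≡-sym eq) = f₀≢g₀
  ... | yes _ with firstDiff (f ∘ suc) (g ∘ suc) in rest
  ...   | nothing = contradiction eq λ ()
  ...   | just q rewrite just-injective (≡-sym eq) = firstDiff-just (f ∘ suc) (g ∘ suc) rest

  firstDiff-exists : ∀ {N} (f g : Fin N → A) → ¬ (f ≗ g) → ∃[ p ] (firstDiff f g ≡ just p)
  firstDiff-exists f g f≉g with firstDiff f g in eq
  ... | just p  = p , refl
  ... | nothing = contradiction (firstDiff-nothing f g eq) f≉g

open FirstDifference (_≟_ {2})

Separating : ∀ {m N} → (Fin m → Fin N → Fin 2) → Set
Separating {N = N} g =
  ∀ (p q : Fin N) α β → (p ≡ q → α ≡ β) → ∃[ i ] (g i p ≡ α × g i q ≡ β)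

SeparatingFamily : ℕ → ℕ → Set
SeparatingFamily m N = Σ (Fin m → Fin N → Fin 2) Separating

separating-base : SeparatingFamily 2 1
separating-base = (λ i _ → i) , realise
  where
  realise : Separating (λ i _ → i)
  realise zero zero α β consistent = α , refl , consistent refl

-- Doubling the positions costs two functions: a position of Fin (2 * N) is a
-- top bit and a remainder in Fin N; add "top bit" and "flipped top bit" and
-- let the old family act on remainders.
separating-double : ∀ {m N} → SeparatingFamily m N → SeparatingFamily (2 + m) (2 * N)
separating-double {m} {N} (g , separates) = g′ , separates′
  where
  top : Fin (2 * N) → Fin 2
  top = quotient N

  rest : Fin (2 * N) → Fin N
  rest = remainder {2} N

  g′ : Fin (2 + m) → Fin (2 * N) → Fin 2
  g′ zero             p = top p
  g′ (suc zero)       p = flip (top p)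
  g′ (suc (suc i))    p = g i (rest p)

  top-rest-injective : ∀ {p q} → top p ≡ top q → rest p ≡ rest q → p ≡ q
  top-rest-injective {p} {q} t≡ r≡ =
    trans (≡-sym (combine-remQuot N p)) (trans (cong₂ combine t≡ r≡) (combine-remQuot N q))

  viaRest : ∀ {p q α β} → ∃[ i ] (g i (rest p) ≡ α × g i (rest q) ≡ β) →
            ∃[ i ] (g′ i p ≡ α × g′ i q ≡ β)
  viaRest (i , gp , gq) = suc (suc i) , gp , gq

  separates′ : Separating g′
  separates′ p q α β consistent with top p ≟ top q | α ≟ β
  ... | yes t≡ | _       = viaRest (separates (rest p) (rest q) α β (consistent ∘ top-rest-injective t≡))
  ... | no _   | yes α≡β = viaRest (separates (rest p) (rest q) α β (λ _ → α≡β))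
  ... | no t≢  | no α≢β with α ≟ top p
  ...   | yes refl = zero , refl , ≡-sym (other t≢ (≢-sym α≢β))
  ...   | no α≢t   = suc zero , flip-p≡α , flip-q≡β
    where
    α≡tq : α ≡ top q
    α≡tq = other t≢ α≢t
    flip-p≡α : flip (top p) ≡ α
    flip-p≡α = trans (other t≢ (flip-≢ (top p))) (≡-sym α≡tq)
    flip-q≡β : flip (top q) ≡ β
    flip-q≡β = trans (other (≢-sym t≢) (flip-≢ (top q)))
                     (≡-sym (other (≢-sym t≢) (λ β≡tq → α≢β (trans α≡tq (≡-sym β≡tq)))))

separating : ∀ t → SeparatingFamily (2 * t + 2) (2 ^ t)
separating zero    = separating-base
separating (suc t) =
  subst (λ m → SeparatingFamily m (2 ^ suc t)) size (separating-double (separating t))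
  where
  size : 2 + (2 * t + 2) ≡ 2 * suc t + 2
  size = ≡-sym (trans (cong (_+ 2) (*-suc 2 t)) (+-assoc 2 (2 * t) 2))

module BitColouringCovering {n m N} (G : Graph n)
    (g : Fin m → Fin N → Fin 2) (separates : Separating g)
    (col : Fin n → Fin N → Fin 2)
    (proper : ∀ x y → Adj G x y → ¬ (col x ≗ col y)) where

  Arc : Fin m → Fin n → Fin n → Set
  Arc i x y = Adj G x y × ∃[ p ] (firstDiff (col x) (col y) ≡ just p × g i p ≡ col y p)

  edgeDiff : ∀ {x y} → Adj G x y → ∃[ p ] (firstDiff (col x) (col y) ≡ just p)
  edgeDiff {x} {y} e = firstDiff-exists (col x) (col y) (proper x y e)

  swapDiff : ∀ {x y p} → firstDiff (col x) (col y) ≡ just p → firstDiff (col y) (col x) ≡ just p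
  swapDiff {x} {y} eq = trans (firstDiff-sym (col y) (col x)) eq

  arc-orientation : ∀ i → IsOrientation G (Arc i)
  arc-orientation i = record { arc⇒edge = λ (e , _) → e ; edge⇒arc = direct ; antisym = antisym }
    where
    direct : ∀ {x y} → Adj G x y → Arc i x y ⊎ Arc i y x
    direct {x} {y} e with edgeDiff e
    ... | p , eq with g i p ≟ col y p
    ...   | yes agrees-y = inj₁ (e , p , eq , agrees-y)
    ...   | no ¬agrees-y =
            inj₂ (Graph.sym G e , p , swapDiff eq ,
                  other (≢-sym (firstDiff-just (col x) (col y) eq)) ¬agrees-y)

    antisym : ∀ {x y} → Arc i x y → ¬ Arc i y x
    antisym {x} {y} (_ , p , eq , gp≡y) (_ , p′ , eq′ , gp′≡x)
      with just-injective (trans (≡-sym (swapDiff eq)) eq′)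
    ... | refl = firstDiff-just (col x) (col y) eq (trans (≡-sym gp′≡x) gp≡y)

  -- For neighbours y, z of x, the family prescribes y's bit at the first
  -- difference with y and z's bit at the first difference with z; this is
  -- consistent since both are "not x's bit" when the positions coincide.
  arc-covering : ∀ x y z → Adj G x y → Adj G x z → y ≢ z → ∃[ i ] (Arc i x y × Arc i x z)
  arc-covering x y z exy exz _ with edgeDiff exy | edgeDiff exz
  ... | p , eqp | q , eqq with separates p q (col y p) (col z q) consistent
    where
    consistent : p ≡ q → col y p ≡ col z q
    consistent refl = other (firstDiff-just (col x) (col z) eqq)
                            (≢-sym (firstDiff-just (col x) (col y) eqp))
  ...   | i , gp , gq = i , (exy , p , eqp , gp) , (exz , q , eqq , gq)

  covering : 1 ≤ m → HasCoveringOfSize G m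
  covering 1≤m = 1≤m , Arc , arc-orientation , arc-covering

colorable-≤ : ∀ {n k k′} (G : Graph n) → k ≤ k′ → Colorable G k → Colorable G k′
colorable-≤ G k≤k′ (c , proper) =
  (λ u → inject≤ (c u) k≤k′) ,
  λ u v e eq → proper u v e (inject≤-injective k≤k′ k≤k′ (c u) (c v) eq)

colourable⇒covering : ∀ {n} (G : Graph n) t → Colorable G (2 ^ 2 ^ t) → HasCoveringOfSize G (2 * t + 2)
colourable⇒covering G t (c , proper) = covering (≤-trans (s≤s z≤n) (m≤n+m 2 (2 * t)))
  where
  family : SeparatingFamily (2 * t + 2) (2 ^ t)
  family = separating t

  bitsProper : ∀ x y → Adj G x y → ¬ (finToFun (c x) ≗ finToFun (c y))
  bitsProper x y e bits≡ = proper x y e (finToFun-injective (c x) (c y) bits≡)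

  open BitColouringCovering G (proj₁ family) (proj₂ family) (finToFun ∘ c) bitsProper

module CoveringColouring {n s} (G : Graph n)
    (O : Fin (suc s) → Fin n → Fin n → Set)
    (orientation : ∀ i → IsOrientation G (O i))
    (covers : ∀ u v w → Adj G u v → Adj G u w → v ≢ w → ∃[ i ] (O i u v × O i u w))
    (O? : ∀ i u v → Dec (O i u v)) where

  open IsOrientation

  signature : Fin n → Fin n → Fin (2 ^ s)
  signature u v = funToFin (λ i → indicator (O? (suc i) u v))

  OutSignature : Fin n → Fin (2 ^ s) → Set
  OutSignature u j = ∃[ v ] (O zero u v × signature u v ≡ j)

  OutSignature? : ∀ u j → Dec (OutSignature u j)
  OutSignature? u j = any? (λ v → O? zero u v ×-dec (signature u v ≟ j))

  outSignatures : Fin n → Fin (2 ^ s) → Fin 2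
  outSignatures u j = indicator (OutSignature? u j)

  colour : Fin n → Fin (2 ^ 2 ^ s)
  colour u = funToFin (outSignatures u)

  signature-transfer : ∀ {u v x y} → signature u v ≡ signature x y →
                       ∀ i → O (suc i) u v → O (suc i) x y
  signature-transfer {u} {v} {x} {y} eq i =
    indicator-transfer (O? (suc i) u v) (O? (suc i) x y) (funToFin-injective _ _ eq i)

  -- Otherwise v has an out-arc vx in O₀ with the signature of uv, and the
  -- orientation containing vu and vx contradicts uv ∈ O₀ or the signatures.
  arc-separates : ∀ {u v} → Adj G u v → O zero u v → ¬ (outSignatures u ≗ outSignatures v)
  arc-separates {u} {v} e uv same
    with indicator-transfer (OutSignature? u (signature u v)) (OutSignature? v (signature u v))
           (same (signature u v)) (v , uv , refl)
  ... | x , vx , sig≡ with covers v u x (Graph.sym G e) (arc⇒edge (orientation zero) vx) u≢x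
    where
    u≢x : u ≢ x
    u≢x refl = antisym (orientation zero) uv vx
  ...   | zero  , vu , _  = antisym (orientation zero) uv vu
  ...   | suc i , vu , vx′ = antisym (orientation (suc i)) (signature-transfer sig≡ i vx′) vu

  colour-proper : ∀ u v → Adj G u v → colour u ≢ colour v
  colour-proper u v e eq with edge⇒arc (orientation zero) e
  ... | inj₁ uv = arc-separates e uv (funToFin-injective _ _ eq)
  ... | inj₂ vu = arc-separates (Graph.sym G e) vu (≡-sym ∘ funToFin-injective _ _ eq)

¬¬-Π-Fin : ∀ {m} {P : Fin m → Set} → (∀ i → ¬ ¬ P i) → ¬ ¬ (∀ i → P i)
¬¬-Π-Fin {zero}  _   refute = refute λ ()
¬¬-Π-Fin {suc m} ¬¬P refute =
  ¬¬P zero λ P₀ → ¬¬-Π-Fin (¬¬P ∘ suc) λ Pₛ → refute λ { zero → P₀ ; (suc i) → Pₛ i }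

-- Classically every relation is decidable; under a double negation this
-- gives a colouring from any covering of size s + 1.
covering⇒¬¬colourable : ∀ {n s} (G : Graph n) → OrientationCovering G (suc s) →
                        ¬ ¬ Colorable G (2 ^ 2 ^ s)
covering⇒¬¬colourable {s = s} G (O , orientation , covers) =
  ¬¬-map colouring (¬¬-Π-Fin λ i → ¬¬-Π-Fin λ u → ¬¬-Π-Fin λ v → ¬¬-excluded-middle)
  where
  colouring : (∀ i u v → Dec (O i u v)) → Colorable G (2 ^ 2 ^ s)
  colouring O? = colour , colour-proper
    where open CoveringColouring G O orientation covers O?

-- σ(G) ≥ ⌈log₂ log₂ χ(G)⌉ + 1: a minimum covering of size s + 1 shows
-- χ ≤ 2^(2^s), so t ≤ s by minimality of t.  The inequality is decidable,
-- hence it may be derived under a double negation.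
lowerBound : ∀ {n} (G : Graph n) (χ s t : ℕ) →
  IsChromaticNumber G χ → IsSigma G s → IsCeilLogLog χ t → t + 1 ≤ s
lowerBound G χ zero    t _           ((() , _) , _) _
lowerBound G χ (suc s) t (_ , χ-min) ((_ , cover) , _) (_ , t-min) =
  subst (_≤ suc s) (+-comm 1 t) (s≤s (decidable-stable (t ≤? s) ¬¬t≤s))
  where
  ¬¬t≤s : ¬ ¬ (t ≤ s)
  ¬¬t≤s = ¬¬-map (λ colouring → t-min s (χ-min (2 ^ 2 ^ s) colouring))
                 (covering⇒¬¬colourable G cover)

upperBound : ∀ {n} (G : Graph n) (χ s t : ℕ) →
  IsChromaticNumber G χ → IsSigma G s → IsCeilLogLog χ t → s ≤ 2 * t + 2
upperBound G χ s t (colouring , _) (_ , s-min) (χ≤ , _) =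
  s-min (2 * t + 2) (colourable⇒covering G t (colorable-≤ G χ≤ colouring))

corollary12 : ∀ {n} (G : Graph n) (χ s t : ℕ) →
    IsChromaticNumber G χ → 2 ≤ χ → IsSigma G s → IsCeilLogLog χ t →
    (t + 1 ≤ s) × (s ≤ 2 * t + 2)
corollary12 G χ s t hχ _ hσ ht = lowerBound G χ s t hχ hσ ht , upperBound G χ s t hχ hσ ht
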